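{- Let $\mathbf{U}=(\mathbf{T},G,H)$ be an $\mathrm{itKI}_{c1}$-algebra and let $S$ be a tense 1-filter of $\mathrm{C}(\mathbf{U})$. Then $D_S=\{u\in T:\ \sim u\Rightarrow c\in S\text{ and }1\Rightarrow(u\vee c)\in S\}$ is a tense deductive system of $\mathbf{U}$ such that $D_S\cap C(T)=S$. Furthermore, $D_S$ is a centered tense deductive system of $\mathbf{U}$.
   Context: A centered Kleene algebra is $\langle T,\wedge,\vee,\sim,c,0,1\rangle$ with bounded distributive lattice reduct, $\sim\sim x=x$, $\sim(x\vee y)=\sim x\wedge\sim y$, $x\wedge\sim x\le y\vee\sim y$, $\sim c=c$. A KI-algebra is $\langle T,\wedge,\vee,\Rightarrow,\sim,c,0,1\rangle$ with centered Kleene reduct such that: $(a\Rightarrow b)\wedge(a\Rightarrow d)=a\Rightarrow(b\wedge d)$, $(a\Rightarrow d)\wedge(b\Rightarrow d)=(a\vee b)\Rightarrow d$, $0\Rightarrow a=1$, $a\Rightarrow 1=1$; $(x\wedge(x\Rightarrow y))\vee c\le y\vee c$; $c\Rightarrow c=1$; $(x\Rightarrow y)\wedge c=(\sim x\vee y)\wedge c$; $(x\Rightarrow\sim y)\vee c=(x\Rightarrow(\sim y\vee c))\wedge(y\Rightarrow(\sim x\vee c))$. A tense centered KI-algebra is $(\mathbf{T},G,H)$ with $F(x):=\sim G(\sim x)$, $P(x):=\sim H(\sim x)$, satisfying $G(1)=H(1)=1$; $G,H$ preserve $\wedge$; $x\le GP(x)$, $x\le HF(x)$; $G(x\vee y)\le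 G(x)\vee F(y)$, $H(x\vee y)\le H(x)\vee P(y)$; $G(x\Rightarrow y)\le G(x)\Rightarrow G(y)$, $H(x\Rightarrow y)\le H(x)\Rightarrow H(y)$; $G(x\Rightarrow y)\le F(x)\Rightarrow F(y)$, $H(x\Rightarrow y)\le P(x)\Rightarrow P(y)$; $G(c)=c=H(c)$. An $\mathrm{itKI}_{c1}$-algebra is a tense centered KI-algebra satisfying $x\Rightarrow x=1$ and (CK): for all $x,y\ge c$ with $x\wedge y\le c$ there is $z$ with $z\vee c=x$ and $\sim z\vee c=y$. $C(T)=\{x\in T:x\ge c\}$; $\mathrm{C}(\mathbf{U})$ is $C(T)$ with $\wedge,\vee,\Rightarrow,G,H,F,P$ restricted. A tense 1-filter of $\mathrm{C}(\mathbf{U})$ is a lattice filter $S$ of $C(T)$ with $((a\wedge f)\Rightarrow b)\Rightarrow(a\Rightarrow b)\in S$ for all $a,b\in C(T)$, $f\in S$, closed under $G,H$. A tense deductive system of $\mathbf{U}$ is $D\subseteq T$ with $1\in D$; $u,u\Rightarrow v\in D$ implies $v\in D$; $u\in D$ implies $G(u),H(u)\in D$. It is centered if $D\cap C(T)$ is a tense 1-filter of $\mathrm{C}(\mathbf{U})$ and for every $u\in T$, $\sim u\Rightarrow c\in D$ and $1\Rightarrow(u\vee c)\in D$ imply $u\in D$. -}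

module Defs where

open import Level using (0ℓ)
open import Relation.Binary.PropositionalEquality using (_≡_)
open import Relation.Unary using (Pred)
open import Data.Product using (Σ; _×_)

record ItKIc1Algebra : Set₁ where
  infixr 6 _∧_
  infixr 5 _∨_
  infixr 4 _⇒_
  field
    T   : Set
    _∧_ _∨_ _⇒_ : T → T → T
    ∼   : T → T
    c 𝟘 𝟙 : T
    G H : T → T

  _≤_ : T → T → Set
  x ≤ y = (x ∧ y) ≡ x

  F : T → T
  F x = ∼ (G (∼ x))

  P : T → T
  P x = ∼ (H (∼ x))

  field
    ∧-assoc : ∀ x y z → ((x ∧ y) ∧ z) ≡ (x ∧ (y ∧ z))
    ∨-assoc : ∀ x y z → ((x ∨ y) ∨ z) ≡ (x ∨ (y ∨ z))
    ∧-comm  : ∀ x y → (x ∧ y) ≡ (y ∧ x)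
    ∨-comm  : ∀ x y → (x ∨ y) ≡ (y ∨ x)
    ∧-absorb-∨ : ∀ x y → (x ∧ (x ∨ y)) ≡ x
    ∨-absorb-∧ : ∀ x y → (x ∨ (x ∧ y)) ≡ x
    ∧-distrib-∨ : ∀ x y z → (x ∧ (y ∨ z)) ≡ ((x ∧ y) ∨ (x ∧ z))
    ∨-identity-𝟘 : ∀ x → (x ∨ 𝟘) ≡ x
    ∧-identity-𝟙 : ∀ x → (x ∧ 𝟙) ≡ x
    ∼-invol : ∀ x → ∼ (∼ x) ≡ x
    ∼-deMorgan : ∀ x y → ∼ (x ∨ y) ≡ (∼ x ∧ ∼ y)
    kleene : ∀ x y → (x ∧ ∼ x) ≤ (y ∨ ∼ y)
    ∼c : ∼ c ≡ c
    KI1 : ∀ a b d → ((a ⇒ b) ∧ (a ⇒ d)) ≡ (a ⇒ (b ∧ d))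
    KI2 : ∀ a b d → ((a ⇒ d) ∧ (b ⇒ d)) ≡ ((a ∨ b) ⇒ d)
    KI3 : ∀ a → (𝟘 ⇒ a) ≡ 𝟙
    KI4 : ∀ a → (a ⇒ 𝟙) ≡ 𝟙
    KI5 : ∀ x y → ((x ∧ (x ⇒ y)) ∨ c) ≤ (y ∨ c)
    KI6 : (c ⇒ c) ≡ 𝟙
    KI7 : ∀ x y → ((x ⇒ y) ∧ c) ≡ ((∼ x ∨ y) ∧ c)
    KI8 : ∀ x y → ((x ⇒ ∼ y) ∨ c) ≡ ((x ⇒ (∼ y ∨ c)) ∧ (y ⇒ (∼ x ∨ c)))
    G𝟙 : G 𝟙 ≡ 𝟙
    H𝟙 : H 𝟙 ≡ 𝟙
    G-∧ : ∀ x y → G (x ∧ y) ≡ (G x ∧ G y)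
    H-∧ : ∀ x y → H (x ∧ y) ≡ (H x ∧ H y)
    x≤GPx : ∀ x → x ≤ G (P x)
    x≤HFx : ∀ x → x ≤ H (F x)
    G-∨ : ∀ x y → G (x ∨ y) ≤ (G x ∨ F y)
    H-∨ : ∀ x y → H (x ∨ y) ≤ (H x ∨ P y)
    G-⇒ : ∀ x y → G (x ⇒ y) ≤ (G x ⇒ G y)
    H-⇒ : ∀ x y → H (x ⇒ y) ≤ (H x ⇒ H y)
    G-⇒F : ∀ x y → G (x ⇒ y) ≤ (F x ⇒ F y)
    H-⇒P : ∀ x y → H (x ⇒ y) ≤ (P x ⇒ P y)
    Gc : G c ≡ c
    Hc : H c ≡ c
    ⇒-refl : ∀ x → (x ⇒ x) ≡ 𝟙
    CK : ∀ x y → c ≤ x → c ≤ y → (x ∧ y) ≤ c →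
         Σ T (λ z → ((z ∨ c) ≡ x) × ((∼ z ∨ c) ≡ y))

  C : Pred T 0ℓ
  C x = c ≤ x

  record Tense1Filter (S : Pred T 0ℓ) : Set where
    field
      ⊆C       : ∀ x → S x → C x
      nonempty : Σ T S
      up-closed : ∀ x y → S x → C y → x ≤ y → S y
      ∧-closed : ∀ x y → S x → S y → S (x ∧ y)
      one-cond : ∀ a b f → C a → C b → S f →
                 S (((a ∧ f) ⇒ b) ⇒ (a ⇒ b))
      G-closed : ∀ x → S x → S (G x)
      H-closed : ∀ x → S x → S (H x)

  record TenseDS (D : Pred T 0ℓ) : Set where
    field
      has𝟙 : D 𝟙
      mp   : ∀ u v → D u → D (u ⇒ v) → D v
      G-closed : ∀ u → D u → D (G u)
      H-closed : ∀ u → D u → D (H u)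

  record CenteredTDS (D : Pred T 0ℓ) : Set where
    field
      tds : TenseDS D
      filter : Tense1Filter (λ x → D x × C x)
      centered : ∀ u → D (∼ u ⇒ c) → D (𝟙 ⇒ (u ∨ c)) → D u

  D[_] : Pred T 0ℓ → Pred T 0ℓ
  D[ S ] u = S (∼ u ⇒ c) × S (𝟙 ⇒ (u ∨ c))

-- An element u lies in D_S when both of its shadows in C(T), the negative part ∼ u ⇒ c and
-- the positive part u ∨ c, lie in S (for u ∨ c this is equivalent to 1 ⇒ (u ∨ c) ∈ S).
-- Everything rests on one consequence of the 1-filter condition: a hypothesis f ∈ S can be
-- discharged, i.e. (a ∧ f) ⇒ b ∈ S gives a ⇒ b ∈ S. Modus ponens for the positive parts is
-- (u ⇒ v) ∨ c ≤ (u ∨ c) ⇒ (v ∨ c); for the negative parts it is a discharge of f = u ∨ c,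
-- because ∼ (u ⇒ v) ∨ c = (∼ v ∨ c) ∧ (u ∨ c) and x ⇒ c = (x ∨ c) ⇒ c. Likewise S ⊆ D_S is a
-- discharge of f = u, as (∼ u ∨ c) ∧ u = c for u ≥ c. Closure under G and H is inherited
-- from S through G (x ⇒ y) ≤ F x ⇒ F y and G (x ∨ c) ≤ G x ∨ c.
module Submission where

open import Defs
open import Level using (0ℓ)
open import Data.Product using (_×_; _,_; proj₁; proj₂)
open import Function.Bundles using (_⇔_; mk⇔)
open import Relation.Unary using (Pred; _⊆_; _≐_; _∩_)
open import Relation.Binary.PropositionalEquality
  using (_≡_; sym; trans; cong; cong₂; subst; subst₂; module ≡-Reasoning)
open import Relation.Binary.PropositionalEquality.Properties using (isEquivalence)
open import Algebra.Lattice.Bundles using (Lattice)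
import Algebra.Lattice.Properties.Lattice as LatticeProperties
import Relation.Binary.Lattice as OrderLattice
open import Algebra.Consequences.Propositional
  using (comm∧distrˡ⇒distrʳ; distrib∧absorbs⇒distribˡ)

module Properties (U : ItKIc1Algebra) where
  open ItKIc1Algebra U
  open ≡-Reasoning

  lattice : Lattice 0ℓ 0ℓ
  lattice = record
    { Carrier   = T
    ; _≈_       = _≡_
    ; _∨_       = _∨_
    ; _∧_       = _∧_
    ; isLattice = record
      { isEquivalence = isEquivalence
      ; ∨-comm        = ∨-comm
      ; ∨-assoc       = ∨-assoc
      ; ∨-cong        = cong₂ _∨_
      ; ∧-comm        = ∧-comm
      ; ∧-assoc       = ∧-assoc
      ; ∧-cong        = cong₂ _∧_
      ; absorptive    = ∨-absorb-∧ , ∧-absorb-∨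
      }
    }

  open LatticeProperties lattice using (∨-idem; ∨-∧-orderTheoreticLattice)

  -- The library orders a lattice by x ≡ x ∧ y, the algebra by x ∧ y ≡ x.
  private
    module Order = OrderLattice.Lattice ∨-∧-orderTheoreticLattice

  ≤-refl : ∀ {x} → x ≤ x
  ≤-refl = sym Order.refl

  ≤-trans : ∀ {x y z} → x ≤ y → y ≤ z → x ≤ z
  ≤-trans x≤y y≤z = sym (Order.trans (sym x≤y) (sym y≤z))

  x≤x∨y : ∀ x y → x ≤ (x ∨ y)
  x≤x∨y x y = sym (Order.x≤x∨y x y)

  y≤x∨y : ∀ x y → y ≤ (x ∨ y)
  y≤x∨y x y = sym (Order.y≤x∨y x y)

  ∨-least : ∀ {x y z} → x ≤ z → y ≤ z → (x ∨ y) ≤ z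
  ∨-least x≤z y≤z = sym (Order.∨-least (sym x≤z) (sym y≤z))

  ≤⇒∨≡ : ∀ {x y} → x ≤ y → (x ∨ y) ≡ y
  ≤⇒∨≡ {x} {y} x≤y = begin
    x ∨ y        ≡⟨ cong (_∨ y) (sym x≤y) ⟩
    (x ∧ y) ∨ y  ≡⟨ ∨-comm (x ∧ y) y ⟩
    y ∨ (x ∧ y)  ≡⟨ cong (y ∨_) (∧-comm x y) ⟩
    y ∨ (y ∧ x)  ≡⟨ ∨-absorb-∧ y x ⟩
    y            ∎

  x≤𝟙 : ∀ x → x ≤ 𝟙
  x≤𝟙 = ∧-identity-𝟙

  𝟙∨x≡𝟙 : ∀ x → (𝟙 ∨ x) ≡ 𝟙
  𝟙∨x≡𝟙 x = trans (∨-comm 𝟙 x) (≤⇒∨≡ (x≤𝟙 x))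

  𝟙≤⇒≡𝟙 : ∀ {x} → 𝟙 ≤ x → x ≡ 𝟙
  𝟙≤⇒≡𝟙 {x} 𝟙≤x = trans (sym (x≤𝟙 x)) (trans (∧-comm x 𝟙) 𝟙≤x)

  ∧-distribʳ-∨ : ∀ x y z → ((y ∨ z) ∧ x) ≡ ((y ∧ x) ∨ (z ∧ x))
  ∧-distribʳ-∨ = comm∧distrˡ⇒distrʳ ∧-comm ∧-distrib-∨

  ∨-distribˡ-∧ : ∀ x y z → (x ∨ (y ∧ z)) ≡ ((x ∨ y) ∧ (x ∨ z))
  ∨-distribˡ-∧ = distrib∧absorbs⇒distribˡ (cong₂ _∨_) ∨-assoc ∧-comm
    ∨-absorb-∧ ∧-absorb-∨ (∧-distrib-∨ , ∧-distribʳ-∨)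

  ∼-∧ : ∀ x y → ∼ (x ∧ y) ≡ (∼ x ∨ ∼ y)
  ∼-∧ x y = begin
    ∼ (x ∧ y)              ≡⟨ cong ∼ (cong₂ _∧_ (∼-invol x) (∼-invol y)) ⟨
    ∼ (∼ (∼ x) ∧ ∼ (∼ y))  ≡⟨ cong ∼ (∼-deMorgan (∼ x) (∼ y)) ⟨
    ∼ (∼ (∼ x ∨ ∼ y))      ≡⟨ ∼-invol (∼ x ∨ ∼ y) ⟩
    ∼ x ∨ ∼ y              ∎

  ∼𝟘≡𝟙 : ∼ 𝟘 ≡ 𝟙
  ∼𝟘≡𝟙 = 𝟙≤⇒≡𝟙 (subst (_≤ ∼ 𝟘) (∼-invol 𝟙) (∼x≤∼𝟘 (∼ 𝟙)))
    where
    ∼x≤∼𝟘 : ∀ x → ∼ x ≤ ∼ 𝟘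
    ∼x≤∼𝟘 x = trans (sym (∼-deMorgan x 𝟘)) (cong ∼ (∨-identity-𝟘 x))

  ∼𝟙≡𝟘 : ∼ 𝟙 ≡ 𝟘
  ∼𝟙≡𝟘 = trans (cong ∼ (sym ∼𝟘≡𝟙)) (∼-invol 𝟘)

  ∼x∧x≤c : ∀ x → (∼ x ∧ x) ≤ c
  ∼x∧x≤c x = subst₂ _≤_ (∧-comm x (∼ x)) (trans (cong (c ∨_) ∼c) (∨-idem c)) (kleene x c)

  C-∨c : ∀ x → C (x ∨ c)
  C-∨c x = y≤x∨y x c

  C⇒∨c≡ : ∀ {x} → C x → (x ∨ c) ≡ x
  C⇒∨c≡ {x} c≤x = trans (∨-comm x c) (≤⇒∨≡ c≤x)

  ∼x∨c∧x≡c : ∀ {x} → C x → ((∼ x ∨ c) ∧ x) ≡ c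
  ∼x∨c∧x≡c {x} c≤x = begin
    (∼ x ∨ c) ∧ x        ≡⟨ ∧-distribʳ-∨ x (∼ x) c ⟩
    (∼ x ∧ x) ∨ (c ∧ x)  ≡⟨ cong ((∼ x ∧ x) ∨_) c≤x ⟩
    (∼ x ∧ x) ∨ c        ≡⟨ ≤⇒∨≡ (∼x∧x≤c x) ⟩
    c                    ∎

  ⇒-monoʳ : ∀ x {y z} → y ≤ z → (x ⇒ y) ≤ (x ⇒ z)
  ⇒-monoʳ x {y} {z} y≤z = trans (KI1 x y z) (cong (x ⇒_) y≤z)

  C-⇒ : ∀ x {y} → C y → C (x ⇒ y)
  C-⇒ x {y} c≤y = begin
    c ∧ (x ⇒ y)    ≡⟨ ∧-comm c (x ⇒ y) ⟩
    (x ⇒ y) ∧ c    ≡⟨ KI7 x y ⟩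
    (∼ x ∨ y) ∧ c  ≡⟨ ∧-comm (∼ x ∨ y) c ⟩
    c ∧ (∼ x ∨ y)  ≡⟨ ≤-trans c≤y (y≤x∨y (∼ x) y) ⟩
    c              ∎

  x∧[x⇒y]≤y : ∀ x {y} → C y → (x ∧ (x ⇒ y)) ≤ y
  x∧[x⇒y]≤y x {y} c≤y =
    ≤-trans (x≤x∨y (x ∧ (x ⇒ y)) c) (subst (((x ∧ (x ⇒ y)) ∨ c) ≤_) (C⇒∨c≡ c≤y) (KI5 x y))

  𝟙⇒x≤x : ∀ {x} → C x → (𝟙 ⇒ x) ≤ x
  𝟙⇒x≤x {x} c≤x = subst (_≤ x) (trans (∧-comm 𝟙 (𝟙 ⇒ x)) (x≤𝟙 (𝟙 ⇒ x))) (x∧[x⇒y]≤y 𝟙 c≤x)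

  c⇒x≡𝟙 : ∀ {x} → C x → (c ⇒ x) ≡ 𝟙
  c⇒x≡𝟙 c≤x = 𝟙≤⇒≡𝟙 (subst (_≤ _) KI6 (⇒-monoʳ c c≤x))

  ∨c⇒ : ∀ x {y} → C y → ((x ∨ c) ⇒ y) ≡ (x ⇒ y)
  ∨c⇒ x {y} c≤y = begin
    (x ∨ c) ⇒ y            ≡⟨ KI2 x c y ⟨
    (x ⇒ y) ∧ (c ⇒ y)      ≡⟨ cong ((x ⇒ y) ∧_) (c⇒x≡𝟙 c≤y) ⟩
    (x ⇒ y) ∧ 𝟙            ≡⟨ ∧-identity-𝟙 (x ⇒ y) ⟩
    x ⇒ y                  ∎

  [x⇒y]∨c≤[x∨c]⇒[y∨c] : ∀ x y → ((x ⇒ y) ∨ c) ≤ ((x ∨ c) ⇒ (y ∨ c))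
  [x⇒y]∨c≤[x∨c]⇒[y∨c] x y = subst (((x ⇒ y) ∨ c) ≤_) (sym (∨c⇒ x (C-∨c y)))
    (∨-least (⇒-monoʳ x (x≤x∨y y c)) (C-⇒ x (C-∨c y)))

  ∼[x⇒y]∨c : ∀ x y → (∼ (x ⇒ y) ∨ c) ≡ ((∼ y ∨ c) ∧ (x ∨ c))
  ∼[x⇒y]∨c x y = begin
    ∼ (x ⇒ y) ∨ c            ≡⟨ cong (∼ (x ⇒ y) ∨_) ∼c ⟨
    ∼ (x ⇒ y) ∨ ∼ c          ≡⟨ ∼-∧ (x ⇒ y) c ⟨
    ∼ ((x ⇒ y) ∧ c)          ≡⟨ cong ∼ (KI7 x y) ⟩
    ∼ ((∼ x ∨ y) ∧ c)        ≡⟨ ∼-∧ (∼ x ∨ y) c ⟩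
    ∼ (∼ x ∨ y) ∨ ∼ c        ≡⟨ cong₂ _∨_ (∼-deMorgan (∼ x) y) ∼c ⟩
    (∼ (∼ x) ∧ ∼ y) ∨ c      ≡⟨ cong (λ w → (w ∧ ∼ y) ∨ c) (∼-invol x) ⟩
    (x ∧ ∼ y) ∨ c            ≡⟨ ∨-comm (x ∧ ∼ y) c ⟩
    c ∨ (x ∧ ∼ y)            ≡⟨ ∨-distribˡ-∧ c x (∼ y) ⟩
    (c ∨ x) ∧ (c ∨ ∼ y)      ≡⟨ cong₂ _∧_ (∨-comm c x) (∨-comm c (∼ y)) ⟩
    (x ∨ c) ∧ (∼ y ∨ c)      ≡⟨ ∧-comm (x ∨ c) (∼ y ∨ c) ⟩
    (∼ y ∨ c) ∧ (x ∨ c)      ∎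

  module Filter {S : Pred T 0ℓ} (S-filter : Tense1Filter S) where
    open Tense1Filter S-filter

    S-𝟙 : S 𝟙
    S-𝟙 = let (x , x∈S) = nonempty in up-closed x 𝟙 x∈S (x≤𝟙 c) (x≤𝟙 x)

    S-mp : ∀ {x y} → C y → S x → S (x ⇒ y) → S y
    S-mp {x} {y} c≤y x∈S x⇒y∈S =
      up-closed _ y (∧-closed x (x ⇒ y) x∈S x⇒y∈S) c≤y (x∧[x⇒y]≤y x c≤y)

    S-discharge : ∀ {a b f} → C a → C b → S f → S ((a ∧ f) ⇒ b) → S (a ⇒ b)
    S-discharge {a} {b} {f} c≤a c≤b f∈S premise =
      S-mp (C-⇒ a c≤b) premise (one-cond a b f c≤a c≤b f∈S)

    S-discharge-∼⇒c : ∀ {u f} → S f → S (((∼ u ∨ c) ∧ f) ⇒ c) → S (∼ u ⇒ c)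
    S-discharge-∼⇒c {u} f∈S premise =
      subst S (∨c⇒ (∼ u) ≤-refl) (S-discharge (C-∨c (∼ u)) ≤-refl f∈S premise)

    S-𝟙⇒⁺ : ∀ {x} → C x → S x → S (𝟙 ⇒ x)
    S-𝟙⇒⁺ {x} c≤x x∈S = S-discharge (x≤𝟙 c) c≤x x∈S
      (subst S (sym (trans (cong (_⇒ x) 𝟙∧x≡x) (⇒-refl x))) S-𝟙)
      where
      𝟙∧x≡x : (𝟙 ∧ x) ≡ x
      𝟙∧x≡x = trans (∧-comm 𝟙 x) (∧-identity-𝟙 x)

    S-𝟙⇒⁻ : ∀ {x} → C x → S (𝟙 ⇒ x) → S x
    S-𝟙⇒⁻ c≤x 𝟙⇒x∈S = up-closed _ _ 𝟙⇒x∈S c≤x (𝟙⇒x≤x c≤x)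

    D-intro : ∀ {u} → S (∼ u ⇒ c) → S (u ∨ c) → D[ S ] u
    D-intro {u} neg pos = neg , S-𝟙⇒⁺ (C-∨c u) pos

    D⇒S-∨c : ∀ {u} → D[ S ] u → S (u ∨ c)
    D⇒S-∨c {u} (_ , pos) = S-𝟙⇒⁻ (C-∨c u) pos

    D-𝟙 : D[ S ] 𝟙
    D-𝟙 = D-intro (subst S (sym (trans (cong (_⇒ c) ∼𝟙≡𝟘) (KI3 c))) S-𝟙)
                  (subst S (sym (𝟙∨x≡𝟙 c)) S-𝟙)

    D-mp : ∀ {u v} → D[ S ] u → D[ S ] (u ⇒ v) → D[ S ] v
    D-mp {u} {v} u∈D u⇒v∈D = D-intro negative positive
      where
      u∨c∈S : S (u ∨ c)
      u∨c∈S = D⇒S-∨c u∈D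

      positive : S (v ∨ c)
      positive = S-mp (C-∨c v) u∨c∈S
        (up-closed _ _ (D⇒S-∨c u⇒v∈D) (C-⇒ (u ∨ c) (C-∨c v)) ([x⇒y]∨c≤[x∨c]⇒[y∨c] u v))

      negative : S (∼ v ⇒ c)
      negative = S-discharge-∼⇒c u∨c∈S
        (subst S (trans (sym (∨c⇒ (∼ (u ⇒ v)) ≤-refl)) (cong (_⇒ c) (∼[x⇒y]∨c u v)))
          (proj₁ u⇒v∈D))

    D-closed-tense : (K : T → T) → K c ≡ c →
      (∀ x y → K (x ∨ y) ≤ (K x ∨ ∼ (K (∼ y)))) →
      (∀ x y → K (x ⇒ y) ≤ (∼ (K (∼ x)) ⇒ ∼ (K (∼ y)))) →
      (∀ x → S x → S (K x)) → ∀ {u} → D[ S ] u → D[ S ] (K u)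
    D-closed-tense K Kc≡c K-∨ K-⇒ S-K {u} u∈D = D-intro negative positive
      where
      K′c≡c : ∼ (K (∼ c)) ≡ c
      K′c≡c = trans (cong (λ w → ∼ (K w)) ∼c) (trans (cong ∼ Kc≡c) ∼c)

      negative : S (∼ (K u) ⇒ c)
      negative = up-closed _ _ (S-K _ (proj₁ u∈D)) (C-⇒ _ ≤-refl)
        (subst (K (∼ u ⇒ c) ≤_) (cong₂ _⇒_ (cong (λ w → ∼ (K w)) (∼-invol u)) K′c≡c)
          (K-⇒ (∼ u) c))

      positive : S (K u ∨ c)
      positive = up-closed _ _ (S-K _ (D⇒S-∨c u∈D)) (C-∨c (K u))
        (subst (λ w → K (u ∨ c) ≤ (K u ∨ w)) K′c≡c (K-∨ u c))

    S⊆D : S ⊆ D[ S ]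
    S⊆D {u} u∈S = D-intro negative (subst S (sym (C⇒∨c≡ c≤u)) u∈S)
      where
      c≤u : C u
      c≤u = ⊆C u u∈S

      negative : S (∼ u ⇒ c)
      negative = S-discharge-∼⇒c u∈S
        (subst S (sym (trans (cong (_⇒ c) (∼x∨c∧x≡c c≤u)) KI6)) S-𝟙)

    S≐D∩C : S ≐ (D[ S ] ∩ C)
    S≐D∩C = (λ u∈S → S⊆D u∈S , ⊆C _ u∈S)
          , (λ (u∈D , c≤u) → subst S (C⇒∨c≡ c≤u) (D⇒S-∨c u∈D))

  Tense1Filter-resp-≐ : ∀ {S S′ : Pred T 0ℓ} → S ≐ S′ → Tense1Filter S → Tense1Filter S′
  Tense1Filter-resp-≐ {S} {S′} (S⊆S′ , S′⊆S) S-filter = record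
    { ⊆C        = λ x x∈S′ → ⊆C x (S′⊆S x∈S′)
    ; nonempty  = let (x , x∈S) = nonempty in x , S⊆S′ x∈S
    ; up-closed = λ x y x∈S′ c≤y x≤y → S⊆S′ (up-closed x y (S′⊆S x∈S′) c≤y x≤y)
    ; ∧-closed  = λ x y x∈S′ y∈S′ → S⊆S′ (∧-closed x y (S′⊆S x∈S′) (S′⊆S y∈S′))
    ; one-cond  = λ a b f c≤a c≤b f∈S′ → S⊆S′ (one-cond a b f c≤a c≤b (S′⊆S f∈S′))
    ; G-closed  = λ x x∈S′ → S⊆S′ (G-closed x (S′⊆S x∈S′))
    ; H-closed  = λ x x∈S′ → S⊆S′ (H-closed x (S′⊆S x∈S′))
    }
    where open Tense1Filter S-filter

lemma7p10 : (U : ItKIc1Algebra) → let open ItKIc1Algebra U in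
    (S : Pred T 0ℓ) → Tense1Filter S →
    TenseDS D[ S ] × (∀ u → ((D[ S ] u × C u) ⇔ S u)) × CenteredTDS D[ S ]
lemma7p10 U S S-filter = tenseDS , (λ _ → mk⇔ D∩C⊆S S⊆D∩C) , centered
  where
  open ItKIc1Algebra U
  open Properties U
  open Filter S-filter
  open Tense1Filter S-filter using (G-closed; H-closed)

  S⊆D∩C : S ⊆ (D[ S ] ∩ C)
  S⊆D∩C = proj₁ S≐D∩C

  D∩C⊆S : (D[ S ] ∩ C) ⊆ S
  D∩C⊆S = proj₂ S≐D∩C

  tenseDS : TenseDS D[ S ]
  tenseDS = record
    { has𝟙     = D-𝟙
    ; mp       = λ _ _ → D-mp
    ; G-closed = λ _ → D-closed-tense G Gc G-∨ G-⇒F G-closed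
    ; H-closed = λ _ → D-closed-tense H Hc H-∨ H-⇒P H-closed
    }

  centered : CenteredTDS D[ S ]
  centered = record
    { tds      = tenseDS
    ; filter   = Tense1Filter-resp-≐ S≐D∩C S-filter
    ; centered = λ u neg pos →
        D∩C⊆S (neg , C-⇒ (∼ u) ≤-refl) , D∩C⊆S (pos , C-⇒ 𝟙 (C-∨c u))
    }
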